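{- Let $B$ be a graph with $n+1$ vertices that has a universal vertex (a vertex adjacent to all other vertices). Let $G$ be the Snort position on the empty board $B$. Then $G=\pm n=\{n\mid -n\}$, and hence $t(G)=n$.
   Context: Snort is played on a graph under normal play (the player unable to move loses): Left and Right alternately place a piece of their own colour on an empty vertex that is not adjacent to any vertex containing a piece of the opponent. Game equality $G=H$ means $G-H$ is a second-player win; $\{a\mid b\}$ denotes the game whose only Left option is $a$ and only Right option is $b$, and $\pm n=\{n\mid -n\}$. The temperature $t(G)$ is the standard combinatorial-game temperature: the smallest $t\ge -1$ such that $G$ cooled by $t$ is infinitesimally close to a number. -}

module Defs where

open import Data.Nat using (ℕ; zero; suc; _+_)
open import Data.Fin using (Fin; zero; suc; splitAt; _≟_)
open import Data.Sum using ([_,_]′)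
open import Data.Product using (Σ; ∃; _×_; _,_)
open import Data.Bool using (Bool; true; false; _∧_; not; if_then_else_)
open import Data.List using (List; []; _∷_; length; lookup; allFin; filterᵇ)
open import Relation.Binary.PropositionalEquality using (_≡_; _≢_)
open import Relation.Nullary using (does)

data Game : Set where
  mk : (nL : ℕ) → (Fin nL → Game) → (nR : ℕ) → (Fin nR → Game) → Game

neg : Game → Game
neg (mk nL gL nR gR) = mk nR (λ j → neg (gR j)) nL (λ i → neg (gL i))

infixl 6 _⊕_
_⊕_ : Game → Game → Game
G@(mk nL gL nR gR) ⊕ H@(mk mL hL mR hR) =
  mk (nL + mL)
     (λ i → [ (λ i′ → gL i′ ⊕ H) , (λ i′ → G ⊕ hL i′) ]′ (splitAt nL i))
     (nR + mR)
     (λ j → [ (λ j′ → gR j′ ⊕ H) , (λ j′ → G ⊕ hR j′) ]′ (splitAt nR j))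

-- Outcomes under normal play (the player unable to move loses).
mutual
  LeftFirst : Game → Set
  LeftFirst (mk nL gL nR gR) = Σ (Fin nL) λ i → LeftSecond (gL i)

  LeftSecond : Game → Set
  LeftSecond (mk nL gL nR gR) = (j : Fin nR) → LeftFirst (gR j)

mutual
  RightFirst : Game → Set
  RightFirst (mk nL gL nR gR) = Σ (Fin nR) λ j → RightSecond (gR j)

  RightSecond : Game → Set
  RightSecond (mk nL gL nR gR) = (i : Fin nL) → RightFirst (gL i)

SecondPlayerWin : Game → Set
SecondPlayerWin G = LeftSecond G × RightSecond G

infix 4 _≈g_
_≈g_ : Game → Game → Set
G ≈g H = SecondPlayerWin (G ⊕ neg H)

zeroG : Game
zeroG = mk 0 (λ ()) 0 (λ ())

natG : ℕ → Game
natG zero    = zeroG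
natG (suc n) = mk 1 (λ _ → natG n) 0 (λ ())

pm : ℕ → Game
pm n = mk 1 (λ _ → natG n) 1 (λ _ → neg (natG n))

record Graph (m : ℕ) : Set where
  field
    adj    : Fin m → Fin m → Bool
    sym    : ∀ u v → adj u v ≡ adj v u
    irrefl : ∀ v → adj v v ≡ false
open Graph public

IsUniversal : ∀ {m} → Graph m → Fin m → Set
IsUniversal B u = ∀ v → v ≢ u → adj B u v ≡ true

HasUniversalVertex : ∀ {m} → Graph m → Set
HasUniversalVertex B = ∃ λ u → IsUniversal B u

data Cell : Set where
  empty leftPiece rightPiece : Cell

isEmpty isLeft isRight : Cell → Bool
isEmpty empty = true
isEmpty _     = false
isLeft leftPiece = true
isLeft _         = false
isRight rightPiece = true
isRight _          = false

allᵇ : {A : Set} → (A → Bool) → List A → Bool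
allᵇ p []       = true
allᵇ p (x ∷ xs) = p x ∧ allᵇ p xs

Board : ℕ → Set
Board m = Fin m → Cell

legalLeft : ∀ {m} → Graph m → Board m → Fin m → Bool
legalLeft {m} B c v = isEmpty (c v) ∧ allᵇ (λ w → not (adj B v w ∧ isRight (c w))) (allFin m)

legalRight : ∀ {m} → Graph m → Board m → Fin m → Bool
legalRight {m} B c v = isEmpty (c v) ∧ allᵇ (λ w → not (adj B v w ∧ isLeft (c w))) (allFin m)

place : ∀ {m} → Board m → Fin m → Cell → Board m
place c v x w = if does (w ≟ v) then x else c w

-- The fuel k bounds the remaining
-- number of moves; since every move fills an empty vertex, fuel m from
-- the empty board (m vertices) never runs out before moves do.
snortFrom : ∀ {m} → Graph m → ℕ → Board m → Game
snortFrom B zero    c = zeroG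
snortFrom {m} B (suc k) c =
  mk (length ls) (λ i → snortFrom B k (place c (lookup ls i) leftPiece))
     (length rs) (λ j → snortFrom B k (place c (lookup rs j) rightPiece))
  where
  ls = filterᵇ (legalLeft B c) (allFin m)
  rs = filterᵇ (legalRight B c) (allFin m)

snort : ∀ {m} → Graph m → Game
snort {m} B = snortFrom B m (λ _ → empty)

module Submission where

-- After the bookkeeping for moves in a sum, we show: a game of
-- height at most k (no play lasts more than k moves) satisfies G ≤ k and
-- G ≥ -k, since the second player answers every move by a move in the
-- integer.  If Right is stuck in G now and after each of k successive Left
-- moves ("G is a Left reserve of k") then G ≥ k, and symmetrically for
-- Right.  Hence a game of height at most n+1 having a Left option that is a
-- Left reserve of n and a Right option that is a Right reserve of n equals
-- ±n = {n | -n}  (lemma ≈±n).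
--
-- Snort with fuel k has height at most k.  Once a piece sits on u,
-- the opponent can never move again (every vertex is u or adjacent to u),
-- while the owner can keep filling the n remaining empty vertices one by
-- one (the invariant Holding).  So the opening at u gives each player a
-- reserve of n, and the theorem is an instance of ≈±n.

open import Defs hiding (sym)
open import Data.Nat using (ℕ; zero; suc)
open import Data.Fin using (Fin; zero; suc; splitAt; _↑ˡ_; _↑ʳ_; _≟_; punchIn)
open import Data.Fin.Properties using (splitAt-↑ˡ; splitAt-↑ʳ; suc-injective; punchIn-injective; punchInᵢ≢i)
open import Data.Sum using (inj₁; inj₂; _⊎_; [_,_]′)
open import Data.Product using (Σ; _×_; _,_; proj₁; proj₂)
open import Data.Bool using (Bool; true; false; T; _∧_; not)
open import Data.Bool.Properties using (T-∧)
open import Data.Unit using (tt)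
open import Data.Empty using (⊥-elim)
open import Data.List using ([]; _∷_; allFin; filterᵇ)
open import Data.List.Membership.Propositional using (_∈_)
open import Data.List.Membership.Propositional.Properties using (∈-allFin; ∈-lookup; ∈-filter⁺; ∈-filter⁻)
open import Data.List.Relation.Unary.Any using (here; there; index)
open import Data.List.Relation.Unary.Any.Properties using (lookup-index)
open import Relation.Binary.PropositionalEquality using (_≡_; _≢_; refl; sym; trans; subst; cong)
open import Relation.Nullary using (¬_; yes; no)
open import Relation.Nullary.Decidable using (T?; dec-true; dec-false)
open import Function using (_∘_; id)
open import Function.Bundles using (Equivalence)

leftCount rightCount : Game → ℕ
leftCount  (mk nL gL nR gR) = nL
rightCount (mk nL gL nR gR) = nR

leftOption : (G : Game) → Fin (leftCount G) → Game
leftOption (mk nL gL nR gR) = gL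

rightOption : (G : Game) → Fin (rightCount G) → Game
rightOption (mk nL gL nR gR) = gR

⊕-leftOptionˡ : ∀ {nL gL nR gR mL hL mR hR} (i : Fin nL) →
  leftOption (mk nL gL nR gR ⊕ mk mL hL mR hR) (i ↑ˡ mL) ≡ gL i ⊕ mk mL hL mR hR
⊕-leftOptionˡ {nL} {mL = mL} i rewrite splitAt-↑ˡ nL i mL = refl

⊕-leftOptionʳ : ∀ {nL gL nR gR mL hL mR hR} (i : Fin mL) →
  leftOption (mk nL gL nR gR ⊕ mk mL hL mR hR) (nL ↑ʳ i) ≡ mk nL gL nR gR ⊕ hL i
⊕-leftOptionʳ {nL} {mL = mL} i rewrite splitAt-↑ʳ nL mL i = refl

⊕-rightOptionˡ : ∀ {nL gL nR gR mL hL mR hR} (j : Fin nR) →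
  rightOption (mk nL gL nR gR ⊕ mk mL hL mR hR) (j ↑ˡ mR) ≡ gR j ⊕ mk mL hL mR hR
⊕-rightOptionˡ {nR = nR} {mR = mR} j rewrite splitAt-↑ˡ nR j mR = refl

⊕-rightOptionʳ : ∀ {nL gL nR gR mL hL mR hR} (j : Fin mR) →
  rightOption (mk nL gL nR gR ⊕ mk mL hL mR hR) (nR ↑ʳ j) ≡ mk nL gL nR gR ⊕ hR j
⊕-rightOptionʳ {nR = nR} {mR = mR} j rewrite splitAt-↑ʳ nR mR j = refl

leftFirst-⊕ˡ : ∀ {nL gL nR gR} H (i : Fin nL) →
  LeftSecond (gL i ⊕ H) → LeftFirst (mk nL gL nR gR ⊕ H)
leftFirst-⊕ˡ (mk _ _ _ _) i win = i ↑ˡ _ , subst LeftSecond (sym (⊕-leftOptionˡ i)) win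

leftFirst-⊕ʳ : ∀ G {mL hL mR hR} (i : Fin mL) →
  LeftSecond (G ⊕ hL i) → LeftFirst (G ⊕ mk mL hL mR hR)
leftFirst-⊕ʳ (mk _ _ _ _) i win = _ ↑ʳ i , subst LeftSecond (sym (⊕-leftOptionʳ i)) win

rightFirst-⊕ˡ : ∀ {nL gL nR gR} H (j : Fin nR) →
  RightSecond (gR j ⊕ H) → RightFirst (mk nL gL nR gR ⊕ H)
rightFirst-⊕ˡ (mk _ _ _ _) j win = j ↑ˡ _ , subst RightSecond (sym (⊕-rightOptionˡ j)) win

rightFirst-⊕ʳ : ∀ G {mL hL mR hR} (j : Fin mR) →
  RightSecond (G ⊕ hR j) → RightFirst (G ⊕ mk mL hL mR hR)
rightFirst-⊕ʳ (mk _ _ _ _) j win = _ ↑ʳ j , subst RightSecond (sym (⊕-rightOptionʳ j)) win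

leftSecond-⊕ : ∀ G H →
  ((j : Fin (rightCount G)) → LeftFirst (rightOption G j ⊕ H)) →
  ((j : Fin (rightCount H)) → LeftFirst (G ⊕ rightOption H j)) →
  LeftSecond (G ⊕ H)
leftSecond-⊕ (mk nL gL nR gR) (mk mL hL mR hR) inG inH j with splitAt nR j
... | inj₁ a = inG a
... | inj₂ b = inH b

rightSecond-⊕ : ∀ G H →
  ((i : Fin (leftCount G)) → RightFirst (leftOption G i ⊕ H)) →
  ((i : Fin (leftCount H)) → RightFirst (G ⊕ leftOption H i)) →
  RightSecond (G ⊕ H)
rightSecond-⊕ (mk nL gL nR gR) (mk mL hL mR hR) inG inH i with splitAt nL i
... | inj₁ a = inG a
... | inj₂ b = inH b

Height : ℕ → Game → Set
Height zero    (mk nL gL nR gR) = ¬ Fin nL × ¬ Fin nR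
Height (suc k) (mk nL gL nR gR) = (∀ i → Height k (gL i)) × (∀ j → Height k (gR j))

-- A game of height ≤ k satisfies G ≥ -k: Left answers each Right move in G
-- by a move in k (written -(-k) in the difference G - (-k)).
height⇒≥-k : ∀ k G → Height k G → LeftSecond (G ⊕ neg (neg (natG k)))
height⇒≥-k zero    G@(mk _ _ _ _) (_ , noRight) =
  leftSecond-⊕ G _ (λ j → ⊥-elim (noRight j)) (λ ())
height⇒≥-k (suc k) G@(mk _ _ _ _) (_ , rightHeights) =
  leftSecond-⊕ G _ (λ j → leftFirst-⊕ʳ _ zero (height⇒≥-k k _ (rightHeights j))) (λ ())

height⇒≤k : ∀ k G → Height k G → RightSecond (G ⊕ neg (natG k))
height⇒≤k zero    G@(mk _ _ _ _) (noLeft , _) =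
  rightSecond-⊕ G _ (λ i → ⊥-elim (noLeft i)) (λ ())
height⇒≤k (suc k) G@(mk _ _ _ _) (leftHeights , _) =
  rightSecond-⊕ G _ (λ i → rightFirst-⊕ʳ _ zero (height⇒≤k k _ (leftHeights i))) (λ ())

LeftReserve : ℕ → Game → Set
LeftReserve zero    (mk nL gL nR gR) = ¬ Fin nR
LeftReserve (suc k) (mk nL gL nR gR) = ¬ Fin nR × Σ (Fin nL) λ i → LeftReserve k (gL i)

RightReserve : ℕ → Game → Set
RightReserve zero    (mk nL gL nR gR) = ¬ Fin nL
RightReserve (suc k) (mk nL gL nR gR) = ¬ Fin nL × Σ (Fin nR) λ j → RightReserve k (gR j)

-- A Left reserve of k gives G ≥ k: Right can only move in -k, and Left
-- answers each such move from her reserve.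
leftReserve⇒≥k : ∀ k G → LeftReserve k G → LeftSecond (G ⊕ neg (natG k))
leftReserve⇒≥k zero    G@(mk _ _ _ _) noRight =
  leftSecond-⊕ G _ (λ j → ⊥-elim (noRight j)) (λ ())
leftReserve⇒≥k (suc k) G@(mk _ _ _ _) (noRight , i , reserve) =
  leftSecond-⊕ G _ (λ j → ⊥-elim (noRight j)) (λ _ → leftFirst-⊕ˡ _ i (leftReserve⇒≥k k _ reserve))

rightReserve⇒≤-k : ∀ k G → RightReserve k G → RightSecond (G ⊕ neg (neg (natG k)))
rightReserve⇒≤-k zero    G@(mk _ _ _ _) noLeft =
  rightSecond-⊕ G _ (λ i → ⊥-elim (noLeft i)) (λ ())
rightReserve⇒≤-k (suc k) G@(mk _ _ _ _) (noLeft , j , reserve) =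
  rightSecond-⊕ G _ (λ i → ⊥-elim (noLeft i)) (λ _ → rightFirst-⊕ˡ _ j (rightReserve⇒≤-k k _ reserve))

-- A criterion for G = ±n.  In G - ±n = G + {n | -n}: a move in G is
-- answered in ±n (height bound), a move in ±n by the opening into the
-- reserve.
≈±n : ∀ n G → Height (suc n) G →
  Σ (Fin (leftCount G)) (λ i → LeftReserve n (leftOption G i)) →
  Σ (Fin (rightCount G)) (λ j → RightReserve n (rightOption G j)) →
  G ≈g pm n
≈±n n G@(mk _ _ _ _) (leftHeights , rightHeights) (i , leftRes) (j , rightRes) =
  leftSecond-⊕ G _
    (λ j′ → leftFirst-⊕ʳ _ zero (height⇒≥-k n _ (rightHeights j′)))
    (λ _ → leftFirst-⊕ˡ _ i (leftReserve⇒≥k n _ leftRes))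
  , rightSecond-⊕ G _
    (λ i′ → rightFirst-⊕ʳ _ zero (height⇒≤k n _ (leftHeights i′)))
    (λ _ → rightFirst-⊕ˡ _ j (rightReserve⇒≤-k n _ rightRes))

allᵇ-sound : ∀ {A : Set} (p : A → Bool) xs {x} → T (allᵇ p xs) → x ∈ xs → T (p x)
allᵇ-sound p (y ∷ xs) t (here refl) = proj₁ (Equivalence.to T-∧ t)
allᵇ-sound p (y ∷ xs) t (there x∈xs) = allᵇ-sound p xs (proj₂ (Equivalence.to (T-∧ {p y}) t)) x∈xs

allᵇ-complete : ∀ {A : Set} (p : A → Bool) xs → (∀ x → T (p x)) → T (allᵇ p xs)
allᵇ-complete p []       all = tt
allᵇ-complete p (x ∷ xs) all with p x | all x
... | true | _ = allᵇ-complete p xs all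

module SnortMoves {m : ℕ} (B : Graph m) where

  snortHeight : ∀ k c → Height k (snortFrom B k c)
  snortHeight zero    c = (λ ()) , (λ ())
  snortHeight (suc k) c = (λ _ → snortHeight k _) , (λ _ → snortHeight k _)

  leftMoveTo : ∀ k c v (P : Game → Set) → T (legalLeft B c v) →
    P (snortFrom B k (place c v leftPiece)) →
    Σ (Fin (leftCount (snortFrom B (suc k) c))) λ i → P (leftOption (snortFrom B (suc k) c) i)
  leftMoveTo k c v P legal p =
    index v∈ , subst (λ w → P (snortFrom B k (place c w leftPiece))) (lookup-index v∈) p
    where
    v∈ : v ∈ filterᵇ (legalLeft B c) (allFin m)
    v∈ = ∈-filter⁺ (T? ∘ legalLeft B c) (∈-allFin v) legal

  rightMoveTo : ∀ k c v (P : Game → Set) → T (legalRight B c v) →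
    P (snortFrom B k (place c v rightPiece)) →
    Σ (Fin (rightCount (snortFrom B (suc k) c))) λ j → P (rightOption (snortFrom B (suc k) c) j)
  rightMoveTo k c v P legal p =
    index v∈ , subst (λ w → P (snortFrom B k (place c w rightPiece))) (lookup-index v∈) p
    where
    v∈ : v ∈ filterᵇ (legalRight B c) (allFin m)
    v∈ = ∈-filter⁺ (T? ∘ legalRight B c) (∈-allFin v) legal

  leftMoveLegal : ∀ k c → Fin (leftCount (snortFrom B (suc k) c)) →
    Σ (Fin m) λ v → T (legalLeft B c v)
  leftMoveLegal k c i = _ , proj₂ (∈-filter⁻ (T? ∘ legalLeft B c) {xs = allFin m} (∈-lookup i))

  rightMoveLegal : ∀ k c → Fin (rightCount (snortFrom B (suc k) c)) →
    Σ (Fin m) λ v → T (legalRight B c v)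
  rightMoveLegal k c j = _ , proj₂ (∈-filter⁻ (T? ∘ legalRight B c) {xs = allFin m} (∈-lookup j))

place-here : ∀ {m} (c : Board m) v x → place c v x v ≡ x
place-here c v x rewrite dec-true (v ≟ v) refl = refl

place-elsewhere : ∀ {m} (c : Board m) {v x w} → w ≢ v → place c v x w ≡ c w
place-elsewhere c {v} {w = w} w≢v rewrite dec-false (w ≟ v) w≢v = refl

place-cases : ∀ {m} (c : Board m) v x w → place c v x w ≡ x ⊎ place c v x w ≡ c w
place-cases c v x w with w ≟ v
... | yes _ = inj₁ refl
... | no  _ = inj₂ refl

place-preserves : ∀ {m} (P : Cell → Set) {c : Board m} {v x} →
  P x → (∀ w → P (c w)) → ∀ w → P (place c v x w)
place-preserves P {c} {v} {x} Px Pc w with place-cases c v x w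
... | inj₁ eq = subst P (sym eq) Px
... | inj₂ eq = subst P (sym eq) (Pc w)

-- Left's moves are the vertices unobstructed by Right
-- pieces, Right's those unobstructed by Left pieces (definitionally).
unobstructed : ∀ {m} → (Cell → Bool) → Graph m → Board m → Fin m → Bool
unobstructed {m} opp B c v = isEmpty (c v) ∧ allᵇ (λ w → not (adj B v w ∧ opp (c w))) (allFin m)

unobstructed-if-clean : ∀ {m} (B : Graph m) {opp} (c : Board m) v →
  (∀ w → opp (c w) ≡ false) → c v ≡ empty → T (unobstructed opp B c v)
unobstructed-if-clean {m} B c v clean cv rewrite cv =
  allᵇ-complete _ (allFin m) λ w → noConflict (adj B v w) (clean w)
  where
  noConflict : ∀ a {b} → b ≡ false → T (not (a ∧ b))
  noConflict false refl = tt
  noConflict true  refl = tt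

module UniversalVertex {n : ℕ} (B : Graph (suc n)) (u : Fin (suc n)) (univ : IsUniversal B u) where

  open SnortMoves B

  -- A piece on the universal vertex obstructs every vertex for the opponent:
  -- u itself is occupied, every other vertex is adjacent to u.
  blocked : ∀ {opp x} (c : Board (suc n)) v → c u ≡ x → isEmpty x ≡ false → opp x ≡ true →
    ¬ T (unobstructed opp B c v)
  blocked {opp} c v cu occupied hostile free with v ≟ u
  ... | yes refl = subst T (trans (cong isEmpty cu) occupied) (proj₁ (Equivalence.to T-∧ free))
  ... | no v≢u   = subst (T ∘ not) conflict (allᵇ-sound _ (allFin (suc n)) (proj₂ (Equivalence.to (T-∧ {isEmpty (c v)}) free)) (∈-allFin u))
    where
    conflict : adj B v u ∧ opp (c u) ≡ true
    conflict rewrite Graph.sym B v u | univ v v≢u | cu = hostile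

  record Holding (x : Cell) (opp : Cell → Bool) (k : ℕ) (c : Board (suc n)) : Set where
    field
      holdsCentre     : c u ≡ x
      noOpponent      : ∀ w → opp (c w) ≡ false
      spare           : Fin k → Fin (suc n)
      spare-injective : ∀ a b → spare a ≡ spare b → a ≡ b
      spare-empty     : ∀ a → c (spare a) ≡ empty

  holding-opening : ∀ {x opp} → opp x ≡ false → opp empty ≡ false →
    Holding x opp n (place (λ _ → empty) u x)
  holding-opening {x} {opp} ox oe = record
    { holdsCentre     = place-here _ u x
    ; noOpponent      = place-preserves (λ y → opp y ≡ false) ox (λ _ → oe)
    ; spare           = punchIn u
    ; spare-injective = punchIn-injective u
    ; spare-empty     = λ a → place-elsewhere _ (punchInᵢ≢i u a)
    }

  holding-step : ∀ {x opp k c} → opp x ≡ false → (h : Holding x opp (suc k) c) →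
    Holding x opp k (place c (Holding.spare h zero) x)
  holding-step {x} {opp} {c = c} ox h = record
    { holdsCentre     = [ id , (λ eq → trans eq holdsCentre) ]′ (place-cases c (spare zero) x u)
    ; noOpponent      = place-preserves (λ y → opp y ≡ false) ox noOpponent
    ; spare           = spare ∘ suc
    ; spare-injective = λ a b eq → suc-injective (spare-injective (suc a) (suc b) eq)
    ; spare-empty     = λ a → trans (place-elsewhere c (distinct a)) (spare-empty (suc a))
    }
    where
    open Holding h
    distinct : ∀ a → spare (suc a) ≢ spare zero
    distinct a eq with spare-injective (suc a) zero eq
    ... | ()

  leftReserve : ∀ k c → Holding leftPiece isRight k c → LeftReserve k (snortFrom B k c)
  leftReserve zero    c h = λ ()
  leftReserve (suc k) c h =
    rightStuck , leftMoveTo k c (spare zero) (LeftReserve k) spareLegal (leftReserve k _ (holding-step refl h))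
    where
    open Holding h
    rightStuck : ¬ Fin (rightCount (snortFrom B (suc k) c))
    rightStuck j = blocked {opp = isLeft} c _ holdsCentre refl refl (proj₂ (rightMoveLegal k c j))
    spareLegal : T (legalLeft B c (spare zero))
    spareLegal = unobstructed-if-clean B {isRight} c _ noOpponent (spare-empty zero)

  rightReserve : ∀ k c → Holding rightPiece isLeft k c → RightReserve k (snortFrom B k c)
  rightReserve zero    c h = λ ()
  rightReserve (suc k) c h =
    leftStuck , rightMoveTo k c (spare zero) (RightReserve k) spareLegal (rightReserve k _ (holding-step refl h))
    where
    open Holding h
    leftStuck : ¬ Fin (leftCount (snortFrom B (suc k) c))
    leftStuck i = blocked {opp = isRight} c _ holdsCentre refl refl (proj₂ (leftMoveLegal k c i))
    spareLegal : T (legalRight B c (spare zero))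
    spareLegal = unobstructed-if-clean B {isLeft} c _ noOpponent (spare-empty zero)

  leftOpening : Σ (Fin (leftCount (snort B))) λ i → LeftReserve n (leftOption (snort B) i)
  leftOpening = leftMoveTo n _ u (LeftReserve n)
    (unobstructed-if-clean B {isRight} _ u (λ _ → refl) refl) (leftReserve n _ (holding-opening refl refl))

  rightOpening : Σ (Fin (rightCount (snort B))) λ j → RightReserve n (rightOption (snort B) j)
  rightOpening = rightMoveTo n _ u (RightReserve n)
    (unobstructed-if-clean B {isLeft} _ u (λ _ → refl) refl) (rightReserve n _ (holding-opening refl refl))

proposition5p3 : (n : ℕ) (B : Graph (suc n)) → HasUniversalVertex B →
    snort B ≈g pm n
proposition5p3 n B (u , univ) =
  ≈±n n (snort B) (snortHeight (suc n) _) leftOpening rightOpening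
  where
  open SnortMoves B
  open UniversalVertex B u univ
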